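{- Let $G$ be a semicomplete digraph and $l,k$ positive integers. If $G$ has an $(l,k)$-degree tangle, then ${\rm pw}(G)\ge (l-k-1)/2$.
   Context: Digraphs are simple; $G$ is semicomplete if between every two distinct vertices there is at least one edge. $d^+(v)$ is the number of out-neighbors of $v$; $V^+_{\ge d}(G)$ and $V^+_{\le d}(G)$ denote the sets of vertices with $d^+(v)\ge d$ and $d^+(v)\le d$, respectively. For integers $d\ge0$, $l>0$, $k>0$, a $(d,l,k)$-degree tangle is a set $T\subseteq V^+_{\ge d}(G)\cap V^+_{\le d+k}(G)$ with $|T|=l$; an $(l,k)$-degree tangle is a $(d,l,k)$-degree tangle for some $d$. A path-decomposition of $G$ is a sequence $(X_1,\dots,X_m)$ of subsets of $V(G)$ with $\bigcup_iX_i=V(G)$, such that for each edge $(u,v)$ there are $i\ge j$ with $u\in X_i$, $v\in X_j$, and each vertex's bags form an integer interval of indices; width is $\max_i|X_i|-1$; ${\rm pw}(G)$ is the minimum width. -}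

module Defs where

open import Data.Nat using (ℕ; zero; suc; _+_; _*_; _∸_; _≤_; _⊔_)
open import Data.Bool using (Bool; true; false; if_then_else_)
open import Data.Fin using (Fin)
open import Data.Fin.Subset using (Subset; _∈_; ∣_∣)
open import Data.List using (List; foldr; map; allFin)
open import Data.Product using (Σ; ∃; ∃-syntax; _×_; _,_)
open import Data.Sum using (_⊎_)
open import Relation.Binary.PropositionalEquality using (_≡_; _≢_)

-- A digraph on the vertex set Fin n, given by its adjacency relation:
-- adj u v ≡ true  iff  (u , v) is an edge.  A relation cannot contain
-- parallel edges; "simple" additionally forbids loops.
record Digraph : Set where
  field
    n     : ℕ
    adj   : Fin n → Fin n → Bool
    loopless : ∀ v → adj v v ≡ false
open Digraph public

Edge : (G : Digraph) → Fin (n G) → Fin (n G) → Set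
Edge G u v = adj G u v ≡ true

Semicomplete : Digraph → Set
Semicomplete G = ∀ u v → u ≢ v → Edge G u v ⊎ Edge G v u

sumFin : (m : ℕ) → (Fin m → ℕ) → ℕ
sumFin m f = foldr _+_ 0 (map f (allFin m))

-- maximum of a function over all elements of Fin m (0 if m = 0)
maxFin : (m : ℕ) → (Fin m → ℕ) → ℕ
maxFin m f = foldr _⊔_ 0 (map f (allFin m))

outdeg : (G : Digraph) → Fin (n G) → ℕ
outdeg G v = sumFin (n G) (λ w → if adj G v w then 1 else 0)

IsDegreeTangle : (G : Digraph) → (d l k : ℕ) → Subset (n G) → Set
IsDegreeTangle G d l k T =
  (∀ v → v ∈ T → d ≤ outdeg G v × outdeg G v ≤ d + k) × ∣ T ∣ ≡ l

HasDegreeTangle : (G : Digraph) → (l k : ℕ) → Set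
HasDegreeTangle G l k = ∃[ d ] ∃[ T ] IsDegreeTangle G d l k T

record PathDecomposition (G : Digraph) : Set where
  field
    m      : ℕ
    bag    : Fin m → Subset (n G)
    covers : ∀ v → ∃[ i ] v ∈ bag i
    edges  : ∀ u v → Edge G u v →
               ∃[ i ] ∃[ j ] (Data.Fin._≤_ j i × u ∈ bag i × v ∈ bag j)
    interval : ∀ v i j k → Data.Fin._≤_ i j → Data.Fin._≤_ j k →
               v ∈ bag i → v ∈ bag k → v ∈ bag j
open PathDecomposition public

width : {G : Digraph} → PathDecomposition G → ℕ
width D = maxFin (m D) (λ i → ∣ bag D i ∣) ∸ 1

IsPathwidth : (G : Digraph) → ℕ → Set
IsPathwidth G p =
  (∃[ D ] width {G} D ≡ p) × (∀ (D : PathDecomposition G) → p ≤ width D)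

-- A path-decomposition gives every vertex w the interval [start w , end w] of bags
-- containing it, and an edge u → w forces start w ≤ end u.  Let v ∈ T be the tangle
-- vertex whose interval ends first and r ∈ T the one whose interval starts last.  If
-- the two intervals meet, T lies inside the single bag start r.  Otherwise let P be
-- the vertices starting by end v and Q those ending before start r.  P contains v and
-- its out-neighbours, so |P| > d; by semicompleteness Q consists of out-neighbours
-- of r, so |Q| ≤ d + k.  Moreover T ∖ Q ⊆ bag (start r) and P ⊆ bag (end v) ∪ (Q ∖ T),
-- whence l + d + 1 ≤ |T| + |P| ≤ 2 (pw + 1) + d + k.
module Submission where

open import Level using (Level; 0ℓ)
open import Function using (id; _∘_; case_of_)
open import Algebra.Properties.CommutativeSemigroup using (interchange)
open import Data.Bool using (true; false; if_then_else_)
import Data.Bool.Properties as Bool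
open import Data.Empty using (⊥-elim)
open import Data.Fin using (Fin; zero; suc)
import Data.Fin as F
import Data.Fin.Properties as F
open import Data.Fin.Subset using (Subset; inside; outside; _∈_; ∣_∣; Nonempty)
open import Data.Fin.Subset.Properties
  using (_∈?_; p⊆q⇒∣p∣≤∣q∣; nonempty?; Empty-unique; ∣⊥∣≡0)
open import Data.List using (List; foldr; map; allFin; filter)
import Data.List.Extrema as Extrema
open import Data.List.Membership.Propositional.Properties using (∈-filter⁺; ∈-allFin)
open import Data.List.Properties using (map-tabulate; map-cong)
open import Data.List.Relation.Unary.All using (lookup)
open import Data.List.Relation.Unary.All.Properties using (all-filter)
open import Data.Nat using (ℕ; zero; suc; _+_; _*_; _≤_; _<_; _⊔_; z≤n; s≤s)
import Data.Nat.Properties as ℕ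
open import Data.Nat.Tactic.RingSolver using (solve-∀)
open import Data.Product using (∃-syntax; _×_; _,_; proj₁; proj₂)
open import Data.Sum using (_⊎_; inj₁; inj₂; [_,_])
open import Data.Vec using (_∷_; [])
open import Relation.Binary using (TotalOrder)
open import Relation.Binary.PropositionalEquality
  using (_≡_; _≢_; refl; sym; trans; cong; cong₂; subst; module ≡-Reasoning)
open import Relation.Nullary using (Dec; yes; no; does; ¬?; _×-dec_; contradiction)
open import Relation.Unary using (Pred; Decidable; Satisfiable; _⊆_; _∪_; _∩_; ∁)
open import Relation.Unary.Properties using (_∩?_; ∁?)

open import Defs

private
  variable
    a b c ℓ ℓ₁ ℓ₂ : Level

module _ (O : TotalOrder c ℓ₁ ℓ₂) where
  open TotalOrder O using () renaming (Carrier to C; _≤_ to _≼_)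
  open Extrema O using (argmin; argmax; argmin-all; argmax-all; f[argmin]≤f[xs]; f[xs]≤f[argmax])

  minimiser : ∀ {k} {P : Pred (Fin k) ℓ} → Decidable P → (f : Fin k → C) → Satisfiable P →
              ∃[ v ] P v × (∀ {w} → P w → f v ≼ f w)
  minimiser {k = k} P? f (v₀ , Pv₀) =
    argmin f v₀ candidates ,
    argmin-all f Pv₀ (all-filter P? (allFin _)) ,
    λ Pw → lookup (f[argmin]≤f[xs] v₀ candidates) (∈-filter⁺ P? (∈-allFin _) Pw)
    where
    candidates : List (Fin k)
    candidates = filter P? (allFin k)

  maximiser : ∀ {k} {P : Pred (Fin k) ℓ} → Decidable P → (f : Fin k → C) → Satisfiable P →
              ∃[ v ] P v × (∀ {w} → P w → f w ≼ f v)
  maximiser {k = k} P? f (v₀ , Pv₀) =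
    argmax f v₀ candidates ,
    argmax-all f Pv₀ (all-filter P? (allFin _)) ,
    λ Pw → lookup (f[xs]≤f[argmax] v₀ candidates) (∈-filter⁺ P? (∈-allFin _) Pw)
    where
    candidates : List (Fin k)
    candidates = filter P? (allFin k)

foldr-allFin-suc : ∀ {A : Set a} {B : Set b} (_∙_ : A → B → B) e k (f : Fin (suc k) → A) →
  foldr _∙_ e (map f (allFin (suc k))) ≡ f zero ∙ foldr _∙_ e (map (f ∘ suc) (allFin k))
foldr-allFin-suc _∙_ e k f = cong (λ xs → f zero ∙ foldr _∙_ e xs)
  (trans (map-tabulate suc f) (sym (map-tabulate id (f ∘ suc))))

sumFin-suc : ∀ k (f : Fin (suc k) → ℕ) → sumFin (suc k) f ≡ f zero + sumFin k (f ∘ suc)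
sumFin-suc = foldr-allFin-suc _+_ 0

sumFin-cong : ∀ k {f g : Fin k → ℕ} → (∀ i → f i ≡ g i) → sumFin k f ≡ sumFin k g
sumFin-cong k f≗g = cong (foldr _+_ 0) (map-cong f≗g (allFin k))

sumFin-mono : ∀ k {f g : Fin k → ℕ} → (∀ i → f i ≤ g i) → sumFin k f ≤ sumFin k g
sumFin-mono zero    f≤g = z≤n
sumFin-mono (suc k) {f} {g} f≤g rewrite sumFin-suc k f | sumFin-suc k g =
  ℕ.+-mono-≤ (f≤g zero) (sumFin-mono k (f≤g ∘ suc))

sumFin-+ : ∀ k (f g : Fin k → ℕ) → sumFin k (λ i → f i + g i) ≡ sumFin k f + sumFin k g
sumFin-+ zero    f g = refl
sumFin-+ (suc k) f g = begin
  sumFin (suc k) (λ i → f i + g i)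
    ≡⟨ sumFin-suc k _ ⟩
  (f zero + g zero) + sumFin k (λ i → f (suc i) + g (suc i))
    ≡⟨ cong (f zero + g zero +_) (sumFin-+ k (f ∘ suc) (g ∘ suc)) ⟩
  (f zero + g zero) + (sumFin k (f ∘ suc) + sumFin k (g ∘ suc))
    ≡⟨ interchange ℕ.+-commutativeSemigroup (f zero) (g zero) _ _ ⟩
  (f zero + sumFin k (f ∘ suc)) + (g zero + sumFin k (g ∘ suc))
    ≡⟨ cong₂ _+_ (sumFin-suc k f) (sumFin-suc k g) ⟨
  sumFin (suc k) f + sumFin (suc k) g ∎
  where open ≡-Reasoning

term≤sumFin : ∀ k (f : Fin k → ℕ) i → f i ≤ sumFin k f
term≤sumFin (suc k) f zero    rewrite sumFin-suc k f = ℕ.m≤m+n _ _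
term≤sumFin (suc k) f (suc i) rewrite sumFin-suc k f =
  ℕ.≤-trans (term≤sumFin k (f ∘ suc) i) (ℕ.m≤n+m _ _)

term≤maxFin : ∀ k (f : Fin k → ℕ) i → f i ≤ maxFin k f
term≤maxFin (suc k) f zero    rewrite foldr-allFin-suc _⊔_ 0 k f = ℕ.m≤m⊔n _ _
term≤maxFin (suc k) f (suc i) rewrite foldr-allFin-suc _⊔_ 0 k f =
  ℕ.≤-trans (term≤maxFin k (f ∘ suc) i) (ℕ.m≤n⊔m _ _)

χ : {A : Set a} → Dec A → ℕ
χ A? = if does A? then 1 else 0

χ-mono : {A : Set a} {B : Set b} (A? : Dec A) (B? : Dec B) → (A → B) → χ A? ≤ χ B?
χ-mono (no _)  _       _   = z≤n
χ-mono (yes _) (yes _) _   = ℕ.≤-refl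
χ-mono (yes a) (no ¬b) A→B = contradiction (A→B a) ¬b

χ-cover : {A : Set a} {B : Set b} {C : Set c} (A? : Dec A) (B? : Dec B) (C? : Dec C) →
          (A → B ⊎ C) → χ A? ≤ χ B? + χ C?
χ-cover (no _)  _       _       _     = z≤n
χ-cover (yes _) (yes _) _       _     = s≤s z≤n
χ-cover (yes _) (no _)  (yes _) _     = ℕ.≤-refl
χ-cover (yes a) (no ¬b) (no ¬c) A→B⊎C = ⊥-elim ([ ¬b , ¬c ] (A→B⊎C a))

χ-split : {A : Set a} {B : Set b} (A? : Dec A) (B? : Dec B) →
          χ A? ≡ χ (A? ×-dec B?) + χ (A? ×-dec ¬? B?)
χ-split (no _)  _       = refl
χ-split (yes _) (yes _) = refl
χ-split (yes _) (no _)  = refl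

count : ∀ {k} {P : Pred (Fin k) ℓ} → Decidable P → ℕ
count {k = k} P? = sumFin k (χ ∘ P?)

module _ {k} {P : Pred (Fin k) ℓ₁} {Q : Pred (Fin k) ℓ₂} (P? : Decidable P) (Q? : Decidable Q) where

  count-mono : P ⊆ Q → count P? ≤ count Q?
  count-mono P⊆Q = sumFin-mono k (λ i → χ-mono (P? i) (Q? i) P⊆Q)

  count-split : count P? ≡ count (P? ∩? Q?) + count (P? ∩? ∁? Q?)
  count-split = trans (sumFin-cong k (λ i → χ-split (P? i) (Q? i))) (sumFin-+ k _ _)

  count-cover : {R : Pred (Fin k) ℓ} (R? : Decidable R) → P ⊆ Q ∪ R →
                count P? ≤ count Q? + count R?
  count-cover R? P⊆Q∪R =
    ℕ.≤-trans (sumFin-mono k (λ i → χ-cover (P? i) (Q? i) (R? i) P⊆Q∪R))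
              (ℕ.≤-reflexive (sumFin-+ k _ _))

0<count : ∀ {k} {P : Pred (Fin k) ℓ} (P? : Decidable P) {i} → P i → 0 < count P?
0<count P? {i} Pi = ℕ.≤-trans (χ-mono (yes Pi) (P? i) id) (term≤sumFin _ (χ ∘ P?) i)

∣p∣≡count : ∀ {k} (p : Subset k) → ∣ p ∣ ≡ count (_∈? p)
∣p∣≡count []            = refl
∣p∣≡count (inside ∷ p)  =
  trans (cong suc (∣p∣≡count p)) (sym (sumFin-suc _ (χ ∘ (_∈? inside ∷ p))))
∣p∣≡count (outside ∷ p) =
  trans (∣p∣≡count p) (sym (sumFin-suc _ (χ ∘ (_∈? outside ∷ p))))

0<∣p∣⇒nonempty : ∀ {k} (p : Subset k) → 0 < ∣ p ∣ → Nonempty p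
0<∣p∣⇒nonempty {k} p 0<∣p∣ with nonempty? p
... | yes ne = ne
... | no ¬ne = contradiction (trans (cong ∣_∣ (Empty-unique ¬ne)) (∣⊥∣≡0 k)) (ℕ.>⇒≢ 0<∣p∣)

Edge? : (G : Digraph) (u : Fin (n G)) → Decidable (Edge G u)
Edge? G u v = adj G u v Bool.≟ true

outdeg≡count : (G : Digraph) (u : Fin (n G)) → outdeg G u ≡ count (Edge? G u)
outdeg≡count G u = sumFin-cong (n G) (λ v → indicator (adj G u v))
  where
  indicator : ∀ b → (if b then 1 else 0) ≡ χ (b Bool.≟ true)
  indicator true  = refl
  indicator false = refl

edge⇒≢ : (G : Digraph) {u v : Fin (n G)} → Edge G u v → v ≢ u
edge⇒≢ G {u} uv refl with () ← trans (sym uv) (loopless G u)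

1+w≤2w+k+1 : ∀ w k → suc w ≤ 2 * w + k + 1
1+w≤2w+k+1 w k = ℕ.≤-trans (ℕ.m≤m+n (suc w) (w + k)) (ℕ.≤-reflexive (regroup w k))
  where
  regroup : ∀ w k → suc w + (w + k) ≡ 2 * w + k + 1
  regroup = solve-∀

cancel-degree : ∀ {l d} w k → l + suc d ≤ suc w + suc w + (d + k) → l ≤ 2 * w + k + 1
cancel-degree {l} {d} w k bound =
  ℕ.+-cancelʳ-≤ (suc d) l (2 * w + k + 1) (ℕ.≤-trans bound (ℕ.≤-reflexive (regroup w k d)))
  where
  regroup : ∀ w k d → suc w + suc w + (d + k) ≡ 2 * w + k + 1 + suc d
  regroup = solve-∀

module BagInterval {G : Digraph} (D : PathDecomposition G) where

  private
    first-bag : (w : Fin (n G)) → ∃[ i ] w ∈ bag D i × (∀ {j} → w ∈ bag D j → i F.≤ j)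
    first-bag w = minimiser (F.≤-totalOrder (m D)) (λ i → w ∈? bag D i) id (covers D w)

    last-bag : (w : Fin (n G)) → ∃[ i ] w ∈ bag D i × (∀ {j} → w ∈ bag D j → j F.≤ i)
    last-bag w = maximiser (F.≤-totalOrder (m D)) (λ i → w ∈? bag D i) id (covers D w)

  start end : Fin (n G) → Fin (m D)
  start w = proj₁ (first-bag w)
  end   w = proj₁ (last-bag w)

  ∈-start : ∀ w → w ∈ bag D (start w)
  ∈-start w = proj₁ (proj₂ (first-bag w))

  ∈-end : ∀ w → w ∈ bag D (end w)
  ∈-end w = proj₁ (proj₂ (last-bag w))

  start-least : ∀ {w i} → w ∈ bag D i → start w F.≤ i
  start-least {w} = proj₂ (proj₂ (first-bag w))

  end-greatest : ∀ {w i} → w ∈ bag D i → i F.≤ end w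
  end-greatest {w} = proj₂ (proj₂ (last-bag w))

  start≤end : ∀ w → start w F.≤ end w
  start≤end w = start-least (∈-end w)

  ∈-bag : ∀ {w i} → start w F.≤ i → i F.≤ end w → w ∈ bag D i
  ∈-bag {w} {i} s≤i i≤e = interval D w (start w) i (end w) s≤i i≤e (∈-start w) (∈-end w)

  edge⇒start≤end : ∀ {u v} → Edge G u v → start v F.≤ end u
  edge⇒start≤end {u} {v} uv with edges D u v uv
  ... | i , j , j≤i , u∈i , v∈j =
    F.≤-trans (start-least v∈j) (F.≤-trans j≤i (end-greatest u∈i))

module _ {G : Digraph} (D : PathDecomposition G) where
  open BagInterval D

  ∣bag∣≤1+width : ∀ i → ∣ bag D i ∣ ≤ suc (width D)
  ∣bag∣≤1+width i =
    ℕ.≤-trans (term≤maxFin (m D) (λ j → ∣ bag D j ∣) i) (ℕ.m≤n+m∸n _ 1)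

  StartsBy EndsBefore : Fin (m D) → Pred (Fin (n G)) 0ℓ
  StartsBy   i w = start w F.≤ i
  EndsBefore i w = end w F.< i

  StartsBy? : ∀ i → Decidable (StartsBy i)
  StartsBy? i w = start w F.≤? i

  EndsBefore? : ∀ i → Decidable (EndsBefore i)
  EndsBefore? i w = end w F.<? i

  1+outdeg≤count-StartsBy : ∀ v → suc (outdeg G v) ≤ count (StartsBy? (end v))
  1+outdeg≤count-StartsBy v = begin
    suc (outdeg G v)
      ≡⟨ cong suc (outdeg≡count G v) ⟩
    suc (count (Edge? G v))
      ≤⟨ ℕ.+-mono-≤ (0<count (P? ∩? (F._≟ v)) (start≤end v , refl))
                    (count-mono (Edge? G v) (P? ∩? ∁? (F._≟ v)) out-neighbour) ⟩
    count (P? ∩? (F._≟ v)) + count (P? ∩? ∁? (F._≟ v))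
      ≡⟨ count-split P? (F._≟ v) ⟨
    count P? ∎
    where
    open ℕ.≤-Reasoning hiding (start)
    P? : Decidable (StartsBy (end v))
    P? = StartsBy? (end v)
    out-neighbour : Edge G v ⊆ StartsBy (end v) ∩ ∁ (_≡ v)
    out-neighbour vw = edge⇒start≤end vw , edge⇒≢ G vw

  count-EndsBefore≤outdeg : Semicomplete G → ∀ r → count (EndsBefore? (start r)) ≤ outdeg G r
  count-EndsBefore≤outdeg sc r =
    ℕ.≤-trans (count-mono (EndsBefore? (start r)) (Edge? G r) out-neighbour)
              (ℕ.≤-reflexive (sym (outdeg≡count G r)))
    where
    out-neighbour : EndsBefore (start r) ⊆ Edge G r
    out-neighbour {w} w<r with w F.≟ r
    ... | yes refl = contradiction w<r (ℕ.≤⇒≯ (start≤end r))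
    ... | no w≢r with sc r w (w≢r ∘ sym)
    ...   | inj₁ rw = rw
    ...   | inj₂ wr = contradiction w<r (ℕ.≤⇒≯ (edge⇒start≤end wr))

  module _ (T : Subset (n G)) {v r : Fin (n G)}
           (end-least : ∀ {w} → w ∈ T → end v F.≤ end w)
           (start-greatest : ∀ {w} → w ∈ T → start w F.≤ start r) where

    T⊆bag-start : start r F.≤ end v → ∀ {w} → w ∈ T → w ∈ bag D (start r)
    T⊆bag-start r≤v w∈T = ∈-bag (start-greatest w∈T) (F.≤-trans r≤v (end-least w∈T))

    ∣T∣+count-StartsBy≤∣bags∣+count-EndsBefore : end v F.< start r →
      ∣ T ∣ + count (StartsBy? (end v)) ≤
      ∣ bag D (end v) ∣ + ∣ bag D (start r) ∣ + count (EndsBefore? (start r))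
    ∣T∣+count-StartsBy≤∣bags∣+count-EndsBefore v<r = begin
      ∣ T ∣ + count P?
        ≡⟨ cong (_+ count P?) (∣p∣≡count T) ⟩
      count T? + count P?
        ≤⟨ ℕ.+-mono-≤ (count-cover T? Xr? (Q? ∩? T?) T-cover)
                      (count-cover P? Xv? (Q? ∩? ∁? T?) StartsBy-cover) ⟩
      (count Xr? + count (Q? ∩? T?)) + (count Xv? + count (Q? ∩? ∁? T?))
        ≡⟨ interchange ℕ.+-commutativeSemigroup (count Xr?) _ (count Xv?) _ ⟩
      (count Xr? + count Xv?) + (count (Q? ∩? T?) + count (Q? ∩? ∁? T?))
        ≡⟨ cong₂ _+_ (ℕ.+-comm (count Xr?) _) (sym (count-split Q? T?)) ⟩
      count Xv? + count Xr? + count Q?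
        ≡⟨ cong (_+ count Q?) (cong₂ _+_ (∣p∣≡count (bag D (end v))) (∣p∣≡count (bag D (start r)))) ⟨
      ∣ bag D (end v) ∣ + ∣ bag D (start r) ∣ + count Q? ∎
      where
      open ℕ.≤-Reasoning hiding (start)
      P? : Decidable (StartsBy (end v))
      P? = StartsBy? (end v)
      Q? : Decidable (EndsBefore (start r))
      Q? = EndsBefore? (start r)
      T? Xv? Xr? : Decidable (_∈ _)
      T?  = _∈? T
      Xv? = _∈? bag D (end v)
      Xr? = _∈? bag D (start r)

      T-cover : (_∈ T) ⊆ (_∈ bag D (start r)) ∪ (EndsBefore (start r) ∩ (_∈ T))
      T-cover {w} w∈T with Q? w
      ... | yes w<r = inj₂ (w<r , w∈T)
      ... | no w≮r  = inj₁ (∈-bag (start-greatest w∈T) (ℕ.≮⇒≥ w≮r))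

      StartsBy-cover : StartsBy (end v) ⊆ (_∈ bag D (end v)) ∪ (EndsBefore (start r) ∩ ∁ (_∈ T))
      StartsBy-cover {w} w≤v with w ∈? T | Q? w
      ... | yes w∈T | _       = inj₁ (∈-bag w≤v (end-least w∈T))
      ... | no w∉T  | yes w<r = inj₂ (w<r , w∉T)
      ... | no _    | no w≮r  = inj₁ (∈-bag w≤v (ℕ.<⇒≤ (ℕ.<-≤-trans v<r (ℕ.≮⇒≥ w≮r))))

  degreeTangle≤2*width+k+1 : Semicomplete G → ∀ {d l k T} → IsDegreeTangle G d l k T → 0 < l →
                             l ≤ 2 * width D + k + 1
  degreeTangle≤2*width+k+1 sc {d} {l} {k} {T} (degree , ∣T∣≡l) 0<l =
    case start r F.≤? end v of λ where
      (yes r≤v) → begin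
        l                      ≡⟨ ∣T∣≡l ⟨
        ∣ T ∣                  ≤⟨ p⊆q⇒∣p∣≤∣q∣ (T⊆bag-start T end-least start-greatest r≤v) ⟩
        ∣ bag D (start r) ∣    ≤⟨ ∣bag∣≤1+width (start r) ⟩
        suc (width D)          ≤⟨ 1+w≤2w+k+1 (width D) k ⟩
        2 * width D + k + 1    ∎
      (no r≰v) → cancel-degree (width D) k (begin
        l + suc d
          ≤⟨ ℕ.+-monoʳ-≤ l (s≤s (proj₁ (degree v v∈T))) ⟩
        l + suc (outdeg G v)
          ≤⟨ ℕ.+-mono-≤ (ℕ.≤-reflexive (sym ∣T∣≡l)) (1+outdeg≤count-StartsBy v) ⟩
        ∣ T ∣ + count (StartsBy? (end v))
          ≤⟨ ∣T∣+count-StartsBy≤∣bags∣+count-EndsBefore T end-least start-greatest (ℕ.≰⇒> r≰v) ⟩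
        ∣ bag D (end v) ∣ + ∣ bag D (start r) ∣ + count (EndsBefore? (start r))
          ≤⟨ ℕ.+-mono-≤ (ℕ.+-mono-≤ (∣bag∣≤1+width _) (∣bag∣≤1+width _))
                        (count-EndsBefore≤outdeg sc r) ⟩
        suc (width D) + suc (width D) + outdeg G r
          ≤⟨ ℕ.+-monoʳ-≤ _ (proj₂ (degree r r∈T)) ⟩
        suc (width D) + suc (width D) + (d + k) ∎)
    where
    open ℕ.≤-Reasoning hiding (start)
    T-nonempty : Nonempty T
    T-nonempty = 0<∣p∣⇒nonempty T (subst (0 <_) (sym ∣T∣≡l) 0<l)
    v-extremal : ∃[ v ] v ∈ T × (∀ {w} → w ∈ T → end v F.≤ end w)
    v-extremal = minimiser (F.≤-totalOrder (m D)) (_∈? T) end T-nonempty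
    r-extremal : ∃[ r ] r ∈ T × (∀ {w} → w ∈ T → start w F.≤ start r)
    r-extremal = maximiser (F.≤-totalOrder (m D)) (_∈? T) start T-nonempty
    v r : Fin (n G)
    v = proj₁ v-extremal
    r = proj₁ r-extremal
    v∈T : v ∈ T
    v∈T = proj₁ (proj₂ v-extremal)
    r∈T : r ∈ T
    r∈T = proj₁ (proj₂ r-extremal)
    end-least : ∀ {w} → w ∈ T → end v F.≤ end w
    end-least = proj₂ (proj₂ v-extremal)
    start-greatest : ∀ {w} → w ∈ T → start w F.≤ start r
    start-greatest = proj₂ (proj₂ r-extremal)

corollary1 : (G : Digraph) → Semicomplete G → (l k : ℕ) → 0 < l → 0 < k →
    HasDegreeTangle G l k → (p : ℕ) → IsPathwidth G p → l ≤ 2 * p + k + 1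
corollary1 G sc l k 0<l _ (d , T , tangle) p ((D , width≡p) , _) =
  subst (λ q → l ≤ 2 * q + k + 1) width≡p (degreeTangle≤2*width+k+1 D sc tangle 0<l)
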